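{- Let $G$ be a very well-covered graph with $\alpha(G)\leq 5$. Then the independence polynomial $I(G;x)$ is log-concave.
   Context: All graphs are finite, simple, undirected and loopless; $n(G)$ is the number of vertices. An independent set is a set of pairwise non-adjacent vertices; $\alpha(G)$ is the maximum size of an independent set. A graph is well-covered if all its maximal (by inclusion) independent sets have the same size. A graph $G$ is very well-covered if it is well-covered, has no isolated vertices, and $n(G)=2\alpha(G)$. The independence polynomial is $I(G;x)=\sum_{k=0}^{\alpha(G)} s_k x^k$, where $s_k$ is the number of independent sets of size $k$ in $G$; it is log-concave if $s_k^2\geq s_{k-1}s_{k+1}$ for all $1\le k\le \alpha(G)-1$. -}

module Defs where

open import Data.Nat using (ℕ; zero; suc; _+_; _*_; _≤_; _∸_; _⊔_)
open import Data.Bool using (Bool; true; false; _∧_; _∨_; not; if_then_else_)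
open import Data.Fin using (Fin)
open import Data.Fin.Subset using (Subset; _∈_; _∉_; _⊆_; ∣_∣; ⁅_⁆; _∪_)
open import Data.Vec using (Vec; []; _∷_; lookup)
open import Data.List using (List; []; _∷_; map; _++_; filter; length; foldr; allFin)
open import Relation.Binary.PropositionalEquality using (_≡_)
open import Relation.Nullary using (¬_)
open import Data.Product using (_×_; ∃)

record Graph (n : ℕ) : Set where
  field
    adj    : Fin n → Fin n → Bool
    sym    : ∀ i j → adj i j ≡ adj j i
    irrefl : ∀ i → adj i i ≡ false
open Graph public

nV : ∀ {n} → Graph n → ℕ
nV {n} _ = n

-- Boolean test: no two (possibly equal) members of S are adjacent
-- (equal members are never adjacent since the graph is loopless).
isIndep : ∀ {n} → Graph n → Subset n → Bool
isIndep {n} G S =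
  foldr _∧_ true
    (map (λ i → foldr _∧_ true
                  (map (λ j → not (lookup S i ∧ lookup S j ∧ adj G i j))
                       (allFin n)))
         (allFin n))

Independent : ∀ {n} → Graph n → Subset n → Set
Independent G S = isIndep G S ≡ true

MaximalIndependent : ∀ {n} → Graph n → Subset n → Set
MaximalIndependent G S =
  Independent G S × (∀ T → Independent G T → S ⊆ T → T ⊆ S)

allSubsets : (n : ℕ) → List (Subset n)
allSubsets zero    = [] ∷ []
allSubsets (suc n) = map (true ∷_) (allSubsets n) ++ map (false ∷_) (allSubsets n)

bfilter : ∀ {A : Set} → (A → Bool) → List A → List A
bfilter p []       = []
bfilter p (x ∷ xs) = if p x then x ∷ bfilter p xs else bfilter p xs

indepSets : ∀ {n} → Graph n → List (Subset n)
indepSets {n} G = bfilter (isIndep G) (allSubsets n)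

α : ∀ {n} → Graph n → ℕ
α G = foldr _⊔_ 0 (map ∣_∣ (indepSets G))

-- s_k(G): number of independent sets of size k
-- (coefficient of x^k in the independence polynomial I(G;x))
s : ∀ {n} → Graph n → ℕ → ℕ
s G k = length (bfilter (λ S → ∣ S ∣ Data.Nat.≡ᵇ k) (indepSets G))

WellCovered : ∀ {n} → Graph n → Set
WellCovered G = ∀ S T → MaximalIndependent G S → MaximalIndependent G T → ∣ S ∣ ≡ ∣ T ∣

IsolatedVertex : ∀ {n} → Graph n → Fin n → Set
IsolatedVertex {n} G v = ∀ (u : Fin n) → adj G v u ≡ false

NoIsolatedVertices : ∀ {n} → Graph n → Set
NoIsolatedVertices G = ∀ v → ¬ IsolatedVertex G v

VeryWellCovered : ∀ {n} → Graph n → Set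
VeryWellCovered G = WellCovered G × NoIsolatedVertices G × (nV G ≡ 2 * α G)

LogConcave : ∀ {n} → Graph n → Set
LogConcave G = ∀ k → 1 ≤ k → k ≤ α G ∸ 1 →
  s G (k ∸ 1) * s G (suc k) ≤ s G k * s G k

{-# OPTIONS --safe #-}
-- For an independent k-set A of a very well-covered graph with α = p, the independent
-- (k + 1)-sets containing A are the sets A ∪ {w} with w in W(A), the vertices outside A
-- without a neighbour in A (written Addable ⊤ᵥ A). Extending A to a maximal independent set,
-- which has p vertices, gives |W(A)| ≥ p − k. Every independent set satisfies |N(A)| ≥ |A|,
-- so n = 2p gives |W(A)| ≤ 2(p − k). Counting the pairs A ⊂ B of independent sets of sizes
-- k and k + 1 in two ways yields (p − k) s_k ≤ (k + 1) s_{k+1} ≤ 2(p − k) s_k, and the bounds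
-- at k − 1 and k combine to s_{k−1} s_{k+1} ≤ s_k² whenever (k − 1)(p − k − 1) ≤ 2, which
-- holds for every k once p ≤ 5.
--
-- The inequality |N(A)| ≥ |A| is proved together with n(H) ≥ 2α(H) for every well-covered H
-- without isolated vertices, by induction on n(H): for a vertex v of minimum degree, U = N(v)
-- and B = {w | N(w) ⊆ U}, the set B is independent and completely joined to U, |B| ≤ |U|,
-- and H − (U ∪ B) is again well-covered without isolated vertices, with α(H) − |B| in place
-- of α(H).
module Submission where

open import Defs hiding (sym; adj; irrefl)
open import Data.Nat using (ℕ; zero; suc; _+_; _*_; _∸_; _⊔_; _≤_; _<_; z≤n; s≤s; _≡ᵇ_)
import Data.Nat as ℕ
open import Data.Nat.Properties
open import Data.Nat.Tactic.RingSolver using (solve-∀)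
open import Data.Bool using (Bool; true; false; _∧_; _∨_; not)
open import Data.Fin using (Fin; zero; suc)
import Data.Fin as Fin
import Data.Bool.Properties as Bool
open import Data.Bool.Properties using (¬-not)
open import Data.Product using (_×_; _,_; ∃; Σ-syntax; proj₁; proj₂)
import Data.Product as Product
open import Data.Sum using (_⊎_; inj₁; inj₂)
open import Data.Empty using (⊥; ⊥-elim)
open import Function using (_∘_; _$_; Equivalence)
open import Data.List using (List; []; _∷_; map; length; _++_; foldr; filter; allFin)
open import Data.List.Properties using (length-++)
open import Data.Vec using ([]; _∷_; lookup; tabulate)
open import Data.Vec.Properties using (lookup∘tabulate; []=⇒lookup; lookup⇒[]=)
open import Data.Fin.Subset using (Subset; ∣_∣) renaming (_∈_ to _∈ₛ_; _⊆_ to _⊆ₛ_)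
open import Data.Nat.ListAction using (sum)
open import Data.Bool.ListAction using (all)
open import Data.List.Membership.Propositional using (_∈_)
open import Data.List.Relation.Unary.Any using (here; there)
open import Data.List.Extrema.Nat using (argmin; argmin-all; f[argmin]≤f[xs])
import Data.List.Relation.Unary.All as All
open import Data.List.Relation.Unary.All.Properties using (all-filter; all⁺; all⁻; tabulate⁺)
open import Data.List.Membership.Propositional.Properties
  using (∈-filter⁺; ∈-allFin; ∈-map⁺; ∈-++⁺ˡ; ∈-++⁺ʳ)
open import Relation.Binary.PropositionalEquality
open import Relation.Nullary using (does; yes; no; contradiction)
open import Relation.Nullary.Decidable using (dec-false)
open import Algebra.Properties.CommutativeSemigroup +-commutativeSemigroup
  using () renaming (interchange to +-interchange)

private
  variable
    C D : Set
    n : ℕ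

+-squeeze : ∀ {a b x y} → a ≤ x → b ≤ y → x + y ≡ a + b → x ≡ a × y ≡ b
+-squeeze {a} {b} {x} {y} a≤x b≤y x+y≡a+b =
  x≡a , +-cancelˡ-≡ a y b (trans (cong (_+ y) (sym x≡a)) x+y≡a+b)
  where
  x≡a : x ≡ a
  x≡a = ≤-antisym (+-cancelʳ-≤ y x a (≤-trans (≤-reflexive x+y≡a+b) (+-monoʳ-≤ a b≤y))) a≤x

twice-+ : ∀ k r → 2 * (k + r) ≡ 2 * r + (k + k)
twice-+ = solve-∀

small-product : ∀ x y → x + y ≤ 3 → x * y ≤ 2
small-product 0 y _ = z≤n
small-product 1 y (s≤s y≤2) = ≤-trans (≤-reflexive (+-identityʳ y)) y≤2
small-product 2 0 _ = z≤n
small-product 2 1 _ = ≤-refl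
small-product 2 (suc (suc y)) (s≤s (s≤s (s≤s ())))
small-product 3 0 _ = z≤n
small-product 3 (suc y) (s≤s (s≤s (s≤s ())))
small-product (suc (suc (suc (suc x)))) y (s≤s (s≤s (s≤s ())))

log-concavity-step : ∀ x y s₀ s₁ s₂ → x * y ≤ 2 →
                     (2 + y) * s₀ ≤ (1 + x) * s₁ → (2 + x) * s₂ ≤ 2 * (1 + y) * s₁ → s₀ * s₂ ≤ s₁ * s₁
log-concavity-step x y s₀ s₁ s₂ xy≤2 lower upper = *-cancelˡ-≤ ((2 + y) * (2 + x)) $ begin
  (2 + y) * (2 + x) * (s₀ * s₂)            ≡⟨ interchange-* (2 + y) (2 + x) s₀ s₂ ⟩
  (2 + y) * s₀ * ((2 + x) * s₂)            ≤⟨ *-mono-≤ lower upper ⟩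
  (1 + x) * s₁ * (2 * (1 + y) * s₁)        ≡⟨ regroup x y s₁ ⟩
  2 * ((1 + x) * (1 + y)) * (s₁ * s₁)      ≤⟨ *-monoˡ-≤ (s₁ * s₁) coefficients ⟩
  (2 + y) * (2 + x) * (s₁ * s₁)            ∎
  where
  open ≤-Reasoning
  interchange-* : ∀ a b c d → a * b * (c * d) ≡ a * c * (b * d)
  interchange-* = solve-∀
  regroup : ∀ x y s → (1 + x) * s * (2 * (1 + y) * s) ≡ 2 * ((1 + x) * (1 + y)) * (s * s)
  regroup = solve-∀
  expand : ∀ x y → 2 * ((1 + x) * (1 + y)) + 2 ≡ (2 + y) * (2 + x) + x * y
  expand = solve-∀
  coefficients : 2 * ((1 + x) * (1 + y)) ≤ (2 + y) * (2 + x)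
  coefficients = +-cancelʳ-≤ 2 _ _ (≤-trans (≤-reflexive (expand x y)) (+-monoʳ-≤ _ xy≤2))

+-suc-suc : ∀ j d → j + (2 + d) ≡ 2 + (j + d)
+-suc-suc j d = trans (+-suc j (suc d)) (cong suc (+-suc j d))

≤∸1⇒≡+2+ : ∀ {j p} → suc j ≤ p ∸ 1 → ∃ λ d → p ≡ j + (2 + d)
≤∸1⇒≡+2+ {j} {suc p} 1+j≤p =
  p ∸ suc j , trans (cong suc (sym (m+[n∸m]≡n 1+j≤p))) (sym (+-suc-suc j (p ∸ suc j)))

∧-true⁻ : ∀ a {b} → a ∧ b ≡ true → a ≡ true × b ≡ true
∧-true⁻ a {b} a∧b = Bool.∧-conicalˡ a b a∧b , Bool.∧-conicalʳ a b a∧b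

∨-true⁻ : ∀ a {b} → a ∨ b ≡ true → a ≡ true ⊎ b ≡ true
∨-true⁻ true  _      = inj₁ refl
∨-true⁻ false b≡true = inj₂ b≡true

∨-trueˡ : ∀ {a} b → a ≡ true → a ∨ b ≡ true
∨-trueˡ _ refl = refl

∨-trueʳ : ∀ a {b} → b ≡ true → a ∨ b ≡ true
∨-trueʳ a refl = Bool.∨-zeroʳ a

not-true⁻ : ∀ {b} → not b ≡ true → b ≡ false
not-true⁻ {false} _ = refl

≡true⇒≢false : ∀ {b} → b ≡ true → b ≢ false
≡true⇒≢false refl ()

∧-not⁻ : ∀ x {y} → x ∧ not y ≡ true → x ≡ true × y ≡ false
∧-not⁻ true {false} _ = refl , refl

∧-not-false⁻ : ∀ x {y} → x ≡ true → x ∧ not y ≡ false → y ≡ true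
∧-not-false⁻ true {true} _ _ = refl

∧-not-antitone : ∀ x {s t} → (s ≡ true → t ≡ true) → x ∧ not t ≡ true → x ∧ not s ≡ true
∧-not-antitone true  {false}         _   _  = refl
∧-not-antitone true  {true}  {true}  _   ()
∧-not-antitone true  {true}  {false} s⇒t _  = s⇒t refl
∧-not-antitone false                 _   ()

∧-not-∨⁻ : ∀ x y {z} → x ∧ not (y ∨ z) ≡ true → x ≡ true × y ≡ false × z ≡ false
∧-not-∨⁻ true  false {false} _  = refl , refl , refl
∧-not-∨⁻ true  false {true}  ()
∧-not-∨⁻ true  true          ()
∧-not-∨⁻ false _             ()

∧-not-∨⁺ : ∀ {x y z} → x ≡ true → y ≡ false → z ≡ false → x ∧ not (y ∨ z) ≡ true
∧-not-∨⁺ refl refl refl = refl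

∧-absorbˡ : ∀ x {y} → (y ≡ true → x ≡ true) → x ∧ y ≡ y
∧-absorbˡ x {true}  y⇒x = cong (_∧ true) (y⇒x refl)
∧-absorbˡ x {false} _   = Bool.∧-zeroʳ x

∧-rotate : ∀ a b c → a ∧ (b ∧ c) ≡ c ∧ (b ∧ a)
∧-rotate a b c = begin
  a ∧ (b ∧ c)   ≡⟨ Bool.∧-comm a (b ∧ c) ⟩
  (b ∧ c) ∧ a   ≡⟨ cong (_∧ a) (Bool.∧-comm b c) ⟩
  (c ∧ b) ∧ a   ≡⟨ Bool.∧-assoc c b a ⟩
  c ∧ (b ∧ a)   ∎
  where open ≡-Reasoning

≡ᵇ-true⁻ : ∀ m n → (m ≡ᵇ n) ≡ true → m ≡ n
≡ᵇ-true⁻ m n eq = ≡ᵇ⇒≡ m n (Equivalence.from Bool.T-≡ eq)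

≡ᵇ-false⁺ : ∀ m n → m ≢ n → (m ≡ᵇ n) ≡ false
≡ᵇ-false⁺ m n = dec-false (m ℕ.≟ n)

indicator : Bool → ℕ
indicator true  = 1
indicator false = 0

indicator-mono : ∀ {a b} → (a ≡ true → b ≡ true) → indicator a ≤ indicator b
indicator-mono {false} _   = z≤n
indicator-mono {true}  a⇒b rewrite a⇒b refl = ≤-refl

indicator-split : ∀ a b → indicator a ≡ indicator (a ∧ b) + indicator (a ∧ not b)
indicator-split false _     = refl
indicator-split true  true  = refl
indicator-split true  false = refl

indicator-∨ : ∀ {a b} → (a ≡ true → b ≡ true → ⊥) → indicator (a ∨ b) ≡ indicator a + indicator b
indicator-∨ {true}  {true}  a∩b≡∅ = ⊥-elim (a∩b≡∅ refl refl)
indicator-∨ {true}  {false} _     = refl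
indicator-∨ {false}         _     = refl

length-bfilter-∷ : (P : C → Bool) (x : C) (xs : List C) →
                   length (bfilter P (x ∷ xs)) ≡ indicator (P x) + length (bfilter P xs)
length-bfilter-∷ P x xs with P x
... | true  = refl
... | false = refl

bfilter-bfilter : (P Q : C → Bool) (xs : List C) → bfilter P (bfilter Q xs) ≡ bfilter (λ x → Q x ∧ P x) xs
bfilter-bfilter P Q []       = refl
bfilter-bfilter P Q (x ∷ xs) with Q x
... | false = bfilter-bfilter P Q xs
... | true with P x
...   | true  = cong (x ∷_) (bfilter-bfilter P Q xs)
...   | false = bfilter-bfilter P Q xs

bfilter-cong : {P Q : C → Bool} → (∀ x → P x ≡ Q x) → (xs : List C) → bfilter P xs ≡ bfilter Q xs
bfilter-cong         P≗Q []       = refl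
bfilter-cong {P = P} {Q} P≗Q (x ∷ xs) with P x | Q x | P≗Q x
... | true  | .true  | refl = cong (x ∷_) (bfilter-cong P≗Q xs)
... | false | .false | refl = bfilter-cong P≗Q xs

bfilter-++ : (P : C → Bool) (xs ys : List C) → bfilter P (xs ++ ys) ≡ bfilter P xs ++ bfilter P ys
bfilter-++ P []       ys = refl
bfilter-++ P (x ∷ xs) ys with P x
... | true  = cong (x ∷_) (bfilter-++ P xs ys)
... | false = bfilter-++ P xs ys

length-bfilter-map : (P : D → Bool) (f : C → D) (xs : List C) →
                     length (bfilter P (map f xs)) ≡ length (bfilter (P ∘ f) xs)
length-bfilter-map P f []       = refl
length-bfilter-map P f (x ∷ xs) = begin
  length (bfilter P (f x ∷ map f xs))           ≡⟨ length-bfilter-∷ P (f x) (map f xs) ⟩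
  indicator (P (f x)) + length (bfilter P (map f xs)) ≡⟨ cong (indicator (P (f x)) +_) (length-bfilter-map P f xs) ⟩
  indicator (P (f x)) + length (bfilter (P ∘ f) xs)   ≡⟨ sym (length-bfilter-∷ (P ∘ f) x xs) ⟩
  length (bfilter (P ∘ f) (x ∷ xs))             ∎
  where open ≡-Reasoning

∈-bfilter⁺ : (P : C → Bool) {x : C} (xs : List C) → x ∈ xs → P x ≡ true → x ∈ bfilter P xs
∈-bfilter⁺ P (y ∷ xs) (here refl) Px rewrite Px = here refl
∈-bfilter⁺ P (y ∷ xs) (there x∈xs) Px with P y
... | true  = there (∈-bfilter⁺ P xs x∈xs Px)
... | false = ∈-bfilter⁺ P xs x∈xs Px

∈-bfilter⁻ : (P : C → Bool) {x : C} (xs : List C) → x ∈ bfilter P xs → x ∈ xs × P x ≡ true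
∈-bfilter⁻ P (y ∷ xs) x∈ with P y in Py
∈-bfilter⁻ P (y ∷ xs) (here refl)  | true  = here refl , Py
∈-bfilter⁻ P (y ∷ xs) (there x∈)   | true  = Product.map₁ there (∈-bfilter⁻ P xs x∈)
∈-bfilter⁻ P (y ∷ xs) x∈           | false = Product.map₁ there (∈-bfilter⁻ P xs x∈)

sum-map-+ : (f g : C → ℕ) (xs : List C) → sum (map (λ x → f x + g x) xs) ≡ sum (map f xs) + sum (map g xs)
sum-map-+ f g []       = refl
sum-map-+ f g (x ∷ xs) = trans (cong (f x + g x +_) (sum-map-+ f g xs)) (+-interchange (f x) (g x) _ _)

sum-map-const : (c : ℕ) (xs : List C) → sum (map (λ _ → c) xs) ≡ c * length xs
sum-map-const c []       = sym (*-zeroʳ c)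
sum-map-const c (x ∷ xs) = trans (cong (c +_) (sum-map-const c xs)) (sym (*-suc c (length xs)))

sum-map-mono : {f g : C → ℕ} (xs : List C) → (∀ x → x ∈ xs → f x ≤ g x) → sum (map f xs) ≤ sum (map g xs)
sum-map-mono []       _   = z≤n
sum-map-mono (x ∷ xs) f≤g = +-mono-≤ (f≤g x (here refl)) (sum-map-mono xs (λ y → f≤g y ∘ there))

sum-map-cong : {f g : C → ℕ} (xs : List C) → (∀ x → x ∈ xs → f x ≡ g x) → sum (map f xs) ≡ sum (map g xs)
sum-map-cong []       _   = refl
sum-map-cong (x ∷ xs) f≗g = cong₂ _+_ (f≗g x (here refl)) (sum-map-cong xs (λ y → f≗g y ∘ there))

double-counting : (R : C → D → Bool) (xs : List C) (ys : List D) →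
                  sum (map (λ x → length (bfilter (R x) ys)) xs) ≡
                  sum (map (λ y → length (bfilter (λ x → R x y) xs)) ys)
double-counting R [] ys = sym (trans (sum-map-const 0 ys) (*-zeroˡ (length ys)))
double-counting R (x ∷ xs) ys = begin
  length (bfilter (R x) ys) + sum (map (λ x → length (bfilter (R x) ys)) xs)
    ≡⟨ cong₂ _+_ (sym (sum-indicator ys)) (double-counting R xs ys) ⟩
  sum (map (λ y → indicator (R x y)) ys) + sum (map (λ y → length (bfilter (λ x → R x y) xs)) ys)
    ≡⟨ sym (sum-map-+ _ _ ys) ⟩
  sum (map (λ y → indicator (R x y) + length (bfilter (λ x → R x y) xs)) ys)
    ≡⟨ sum-map-cong ys (λ y _ → sym (length-bfilter-∷ (λ x → R x y) x xs)) ⟩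
  sum (map (λ y → length (bfilter (λ x → R x y) (x ∷ xs))) ys) ∎
  where
  open ≡-Reasoning
  sum-indicator : ∀ ys → sum (map (λ y → indicator (R x y)) ys) ≡ length (bfilter (R x) ys)
  sum-indicator []       = refl
  sum-indicator (y ∷ ys) = trans (cong (indicator (R x y) +_) (sum-indicator ys)) (sym (length-bfilter-∷ (R x) y ys))

foldr-⊔-upper : (f : C → ℕ) {x : C} (xs : List C) → x ∈ xs → f x ≤ foldr _⊔_ 0 (map f xs)
foldr-⊔-upper f (y ∷ xs) (here refl) = m≤m⊔n (f y) _
foldr-⊔-upper f (y ∷ xs) (there x∈)  = ≤-trans (foldr-⊔-upper f xs x∈) (m≤n⊔m (f y) _)

foldr-⊔-least : (f : C → ℕ) (xs : List C) {c : ℕ} → (∀ x → x ∈ xs → f x ≤ c) → foldr _⊔_ 0 (map f xs) ≤ c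
foldr-⊔-least f []       _   = z≤n
foldr-⊔-least f (x ∷ xs) f≤c = ⊔-lub (f≤c x (here refl)) (foldr-⊔-least f xs (λ y → f≤c y ∘ there))

all-allFin⁻ : (f : Fin n → Bool) → all f (allFin n) ≡ true → ∀ i → f i ≡ true
all-allFin⁻ {n} f all-f i =
  Equivalence.to Bool.T-≡ (All.lookup (all⁺ f (allFin n) (Equivalence.from Bool.T-≡ all-f)) (∈-allFin i))

all-allFin⁺ : (f : Fin n → Bool) → (∀ i → f i ≡ true) → all f (allFin n) ≡ true
all-allFin⁺ f f≡true = Equivalence.to Bool.T-≡ (all⁻ f (tabulate⁺ (Equivalence.from Bool.T-≡ ∘ f≡true)))

VertexSet : ℕ → Set
VertexSet n = Fin n → Bool

private
  variable
    X Y Z : VertexSet n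

infixr 7 _∩_
infixr 6 _∪_ _─_
infix 4 _⊆_

_∩_ _∪_ _─_ : VertexSet n → VertexSet n → VertexSet n
(X ∩ Y) i = X i ∧ Y i
(X ∪ Y) i = X i ∨ Y i
(X ─ Y) i = X i ∧ not (Y i)

_⊆_ : VertexSet n → VertexSet n → Set
X ⊆ Y = ∀ i → X i ≡ true → Y i ≡ true

⊤ᵥ : VertexSet n
⊤ᵥ _ = true

Disjoint : VertexSet n → VertexSet n → Set
Disjoint X Y = ∀ i → X i ≡ true → Y i ≡ true → ⊥

─-antitone : Y ⊆ Z → X ─ Z ⊆ X ─ Y
─-antitone {X = X} Y⊆Z i = ∧-not-antitone (X i) (Y⊆Z i)

count : VertexSet n → ℕ
count {zero}  X = 0
count {suc n} X = indicator (X zero) + count (X ∘ suc)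

count-cong : (∀ i → X i ≡ Y i) → count X ≡ count Y
count-cong {zero}  _   = refl
count-cong {suc n} X≗Y = cong₂ _+_ (cong indicator (X≗Y zero)) (count-cong (X≗Y ∘ suc))

count-mono : X ⊆ Y → count X ≤ count Y
count-mono {zero}  _   = z≤n
count-mono {suc n} X⊆Y = +-mono-≤ (indicator-mono (X⊆Y zero)) (count-mono (X⊆Y ∘ suc))

count-< : X ⊆ Y → ∀ i → X i ≡ false → Y i ≡ true → count X < count Y
count-< {suc n} {X} {Y} X⊆Y zero Xi Yi rewrite Xi | Yi = s≤s (count-mono (X⊆Y ∘ suc))
count-< {suc n} X⊆Y (suc i) Xi Yi =
  +-mono-≤-< (indicator-mono (X⊆Y zero)) (count-< (X⊆Y ∘ suc) i Xi Yi)

count-≥⇒⊇ : X ⊆ Y → count Y ≤ count X → Y ⊆ X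
count-≥⇒⊇ {X = X} X⊆Y Y≤X i Yi with X i in Xi
... | true  = refl
... | false = ⊥-elim (<⇒≱ (count-< X⊆Y i Xi Yi) Y≤X)

count-empty : (∀ i → X i ≡ false) → count X ≡ 0
count-empty {zero}  _  = refl
count-empty {suc n} X≗∅ rewrite X≗∅ zero = count-empty (X≗∅ ∘ suc)

count-⊤ : count (⊤ᵥ {n}) ≡ n
count-⊤ {zero}  = refl
count-⊤ {suc n} = cong suc (count-⊤ {n})

count-pos : ∀ i → X i ≡ true → 1 ≤ count X
count-pos {suc n} zero    Xi rewrite Xi = s≤s z≤n
count-pos {suc n} {X} (suc i) Xi = ≤-trans (count-pos i Xi) (m≤n+m _ (indicator (X zero)))

count-split : (X Y : VertexSet n) → count X ≡ count (X ∩ Y) + count (X ─ Y)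
count-split {zero}  X Y = refl
count-split {suc n} X Y = begin
  indicator (X zero) + count (X ∘ suc)
    ≡⟨ cong₂ _+_ (indicator-split (X zero) (Y zero)) (count-split (X ∘ suc) (Y ∘ suc)) ⟩
  (indicator (X zero ∧ Y zero) + indicator (X zero ∧ not (Y zero)))
    + (count ((X ∩ Y) ∘ suc) + count ((X ─ Y) ∘ suc))
    ≡⟨ +-interchange (indicator (X zero ∧ Y zero)) _ (count ((X ∩ Y) ∘ suc)) _ ⟩
  count (X ∩ Y) + count (X ─ Y) ∎
  where open ≡-Reasoning

count-∪ : Disjoint X Y → count (X ∪ Y) ≡ count X + count Y
count-∪ {zero}          _    = refl
count-∪ {suc n} {X} {Y} disj = begin
  indicator (X zero ∨ Y zero) + count ((X ∪ Y) ∘ suc)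
    ≡⟨ cong₂ _+_ (indicator-∨ (disj zero)) (count-∪ (disj ∘ suc)) ⟩
  (indicator (X zero) + indicator (Y zero)) + (count (X ∘ suc) + count (Y ∘ suc))
    ≡⟨ +-interchange (indicator (X zero)) _ (count (X ∘ suc)) _ ⟩
  count X + count Y ∎
  where open ≡-Reasoning

count-∩-⊆ : {X Y : VertexSet n} → Y ⊆ X → count (X ∩ Y) ≡ count Y
count-∩-⊆ {X = X} Y⊆X = count-cong λ i → ∧-absorbˡ (X i) (Y⊆X i)

count-partition : (Z U B : VertexSet n) → Disjoint U B →
                  count Z ≡ count (Z ─ (U ∪ B)) + (count (Z ∩ U) + count (Z ∩ B))
count-partition Z U B U∩B≡∅ = begin
  count Z                                      ≡⟨ count-split Z (U ∪ B) ⟩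
  count (Z ∩ (U ∪ B)) + count (Z ─ (U ∪ B))    ≡⟨ cong (_+ count (Z ─ (U ∪ B))) split-boundary ⟩
  (count (Z ∩ U) + count (Z ∩ B)) + count (Z ─ (U ∪ B)) ≡⟨ +-comm _ (count (Z ─ (U ∪ B))) ⟩
  count (Z ─ (U ∪ B)) + (count (Z ∩ U) + count (Z ∩ B)) ∎
  where
  open ≡-Reasoning
  split-boundary : count (Z ∩ (U ∪ B)) ≡ count (Z ∩ U) + count (Z ∩ B)
  split-boundary = trans (count-cong λ i → Bool.∧-distribˡ-∨ (Z i) (U i) (B i))
                         (count-∪ λ i ZUi ZBi → U∩B≡∅ i (proj₂ (∧-true⁻ (Z i) ZUi)) (proj₂ (∧-true⁻ (Z i) ZBi)))

some : VertexSet n → Bool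
some {zero}  X = false
some {suc n} X = X zero ∨ some (X ∘ suc)

some-true⁻ : some X ≡ true → ∃ λ i → X i ≡ true
some-true⁻ {suc n} {X} someX with ∨-true⁻ (X zero) someX
... | inj₁ X0       = zero , X0
... | inj₂ someRest = let i , Xi = some-true⁻ someRest in suc i , Xi

some-false⁻ : some X ≡ false → ∀ i → X i ≡ false
some-false⁻ {suc n} {X} noneX zero    = Bool.∨-conicalˡ (X zero) _ noneX
some-false⁻ {suc n} {X} noneX (suc i) = some-false⁻ (Bool.∨-conicalʳ (X zero) _ noneX) i

some-true⁺ : ∀ i → X i ≡ true → some X ≡ true
some-true⁺ {suc n}     zero    X0 = ∨-trueˡ _ X0
some-true⁺ {suc n} {X} (suc i) Xi = ∨-trueʳ (X zero) (some-true⁺ i Xi)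

some-false⁺ : (∀ i → X i ≡ false) → some X ≡ false
some-false⁺ {zero}  _      = refl
some-false⁺ {suc n} X≗∅ rewrite X≗∅ zero = some-false⁺ (X≗∅ ∘ suc)

⁅_⁆ : Fin n → VertexSet n
⁅ w ⁆ i = does (i Fin.≟ w)

⁅⁆-self : (w : Fin n) → ⁅ w ⁆ w ≡ true
⁅⁆-self w with w Fin.≟ w
... | yes _  = refl
... | no w≢w = ⊥-elim (w≢w refl)

⁅⁆-only : (w i : Fin n) → ⁅ w ⁆ i ≡ true → i ≡ w
⁅⁆-only w i _  with i Fin.≟ w
⁅⁆-only w i _  | yes i≡w = i≡w
⁅⁆-only w i () | no _

minimiser : (d : Fin n → ℕ) (X : VertexSet n) → ∀ v → X v ≡ true →
            Σ[ u ∈ Fin n ] X u ≡ true × (∀ w → X w ≡ true → d u ≤ d w)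
minimiser {n} d X v Xv =
  argmin d v inX ,
  argmin-all d Xv (all-filter X? (allFin n)) ,
  λ w Xw → All.lookup (f[argmin]≤f[xs] v inX) (∈-filter⁺ X? (∈-allFin w) Xw)
  where
  X? = λ w → X w Bool.≟ true
  inX = filter X? (allFin n)

∣∣≡count : (S : Subset n) → ∣ S ∣ ≡ count (lookup S)
∣∣≡count []          = refl
∣∣≡count (true  ∷ S) = cong suc (∣∣≡count S)
∣∣≡count (false ∷ S) = ∣∣≡count S

∣tabulate∣≡count : (X : VertexSet n) → ∣ tabulate X ∣ ≡ count X
∣tabulate∣≡count X = trans (∣∣≡count (tabulate X)) (count-cong (lookup∘tabulate X))

∈-allSubsets : (S : Subset n) → S ∈ allSubsets n
∈-allSubsets []                    = here refl
∈-allSubsets {suc n} (true  ∷ S) = ∈-++⁺ˡ (∈-map⁺ (true ∷_) (∈-allSubsets S))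
∈-allSubsets {suc n} (false ∷ S) = ∈-++⁺ʳ (map (true ∷_) (allSubsets n)) (∈-map⁺ (false ∷_) (∈-allSubsets S))

_⊆ᵇ_ : Subset n → Subset n → Bool
[]       ⊆ᵇ []       = true
(x ∷ xs) ⊆ᵇ (y ∷ ys) = (not x ∨ y) ∧ (xs ⊆ᵇ ys)

⊆ᵇ-lookup : ∀ (S T : Subset n) → S ⊆ᵇ T ≡ true → lookup S ⊆ lookup T
⊆ᵇ-lookup (x ∷ S) (y ∷ T) S⊆T zero    Sx rewrite Sx = proj₁ (∧-true⁻ y S⊆T)
⊆ᵇ-lookup (x ∷ S) (y ∷ T) S⊆T (suc i) Si = ⊆ᵇ-lookup S T (proj₂ (∧-true⁻ (not x ∨ y) S⊆T)) i Si

⊆ᵇ-∣∣ : ∀ (S T : Subset n) → S ⊆ᵇ T ≡ true → ∣ S ∣ ≤ ∣ T ∣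
⊆ᵇ-∣∣ []          []          _   = z≤n
⊆ᵇ-∣∣ (true  ∷ S) (true  ∷ T) S⊆T = s≤s (⊆ᵇ-∣∣ S T S⊆T)
⊆ᵇ-∣∣ (false ∷ S) (true  ∷ T) S⊆T = m≤n⇒m≤1+n (⊆ᵇ-∣∣ S T S⊆T)
⊆ᵇ-∣∣ (false ∷ S) (false ∷ T) S⊆T = ⊆ᵇ-∣∣ S T S⊆T

⊆ᵇ⇒∣∣≢ : ∀ (S T : Subset n) → S ⊆ᵇ T ≡ true → ∣ S ∣ ≢ suc ∣ T ∣
⊆ᵇ⇒∣∣≢ S T S⊆T eq = 1+n≰n (≤-trans (≤-reflexive (sym eq)) (⊆ᵇ-∣∣ S T S⊆T))

insert : Subset n → Fin n → Subset n
insert (x ∷ S) zero    = true ∷ S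
insert (x ∷ S) (suc w) = x ∷ insert S w

lookup-insert : ∀ (S : Subset n) w i → lookup (insert S w) i ≡ (lookup S ∪ ⁅ w ⁆) i
lookup-insert (x ∷ S) zero    zero    = sym (Bool.∨-zeroʳ x)
lookup-insert (x ∷ S) zero    (suc i) = sym (Bool.∨-identityʳ (lookup S i))
lookup-insert (x ∷ S) (suc w) zero    = sym (Bool.∨-identityʳ x)
lookup-insert (x ∷ S) (suc w) (suc i) = lookup-insert S w i

countSubsets : (Subset n → Bool) → ℕ
countSubsets {zero}  P = indicator (P [])
countSubsets {suc n} P = countSubsets (P ∘ (true ∷_)) + countSubsets (P ∘ (false ∷_))

length-bfilter-allSubsets : (P : Subset n → Bool) → length (bfilter P (allSubsets n)) ≡ countSubsets P
length-bfilter-allSubsets {zero}  P = trans (length-bfilter-∷ P [] []) (+-identityʳ _)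
length-bfilter-allSubsets {suc n} P = begin
  length (bfilter P (map (true ∷_) (allSubsets n) ++ map (false ∷_) (allSubsets n)))
    ≡⟨ cong length (bfilter-++ P (map (true ∷_) (allSubsets n)) _) ⟩
  length (bfilter P (map (true ∷_) (allSubsets n)) ++ bfilter P (map (false ∷_) (allSubsets n)))
    ≡⟨ length-++ (bfilter P (map (true ∷_) (allSubsets n))) ⟩
  length (bfilter P (map (true ∷_) (allSubsets n))) + length (bfilter P (map (false ∷_) (allSubsets n)))
    ≡⟨ cong₂ _+_ (count-half true) (count-half false) ⟩
  countSubsets (P ∘ (true ∷_)) + countSubsets (P ∘ (false ∷_)) ∎
  where
  open ≡-Reasoning
  count-half : ∀ b → length (bfilter P (map (b ∷_) (allSubsets n))) ≡ countSubsets (P ∘ (b ∷_))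
  count-half b = trans (length-bfilter-map P (b ∷_) (allSubsets n)) (length-bfilter-allSubsets (P ∘ (b ∷_)))

countSubsets-none : {P : Subset n → Bool} → (∀ S → P S ≡ false) → countSubsets P ≡ 0
countSubsets-none {zero}  P≗false rewrite P≗false [] = refl
countSubsets-none {suc n} P≗false =
  cong₂ _+_ (countSubsets-none (P≗false ∘ (true ∷_))) (countSubsets-none (P≗false ∘ (false ∷_)))

supersets-of-equal-size : (S : Subset n) (P : Subset n → Bool) →
  countSubsets (λ T → S ⊆ᵇ T ∧ ((∣ T ∣ ≡ᵇ ∣ S ∣) ∧ P T)) ≡ indicator (P S)
supersets-of-equal-size [] P with P []
... | true  = refl
... | false = refl
supersets-of-equal-size {suc n} (true ∷ S) P =
  trans (cong₂ _+_ (supersets-of-equal-size S (P ∘ (true ∷_))) (countSubsets-none {n} λ _ → refl)) (+-identityʳ _)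
supersets-of-equal-size {suc n} (false ∷ S) P =
  cong₂ _+_ (countSubsets-none {n} too-big) (supersets-of-equal-size S (P ∘ (false ∷_)))
  where
  too-big : ∀ T → S ⊆ᵇ T ∧ ((suc ∣ T ∣ ≡ᵇ ∣ S ∣) ∧ P (true ∷ T)) ≡ false
  too-big T with S ⊆ᵇ T in S⊆T
  ... | false = refl
  ... | true rewrite ≡ᵇ-false⁺ (suc ∣ T ∣) ∣ S ∣ (≢-sym (⊆ᵇ⇒∣∣≢ S T S⊆T)) = refl

one-point-extensions : (S : Subset n) (P : Subset n → Bool) →
  countSubsets (λ T → S ⊆ᵇ T ∧ ((∣ T ∣ ≡ᵇ suc ∣ S ∣) ∧ P T)) ≡
  count (λ w → not (lookup S w) ∧ P (insert S w))
one-point-extensions []          P = refl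
one-point-extensions {suc n} (true ∷ S) P =
  trans (cong₂ _+_ (one-point-extensions S (P ∘ (true ∷_))) (countSubsets-none {n} λ _ → refl)) (+-identityʳ _)
one-point-extensions (false ∷ S) P =
  cong₂ _+_ (supersets-of-equal-size S (P ∘ (true ∷_))) (one-point-extensions S (P ∘ (false ∷_)))

subsets-of-equal-size : (T : Subset n) → countSubsets (λ S → S ⊆ᵇ T ∧ (∣ S ∣ ≡ᵇ ∣ T ∣)) ≡ 1
subsets-of-equal-size []          = refl
subsets-of-equal-size {suc n} (true ∷ T) =
  cong₂ _+_ (subsets-of-equal-size T) (countSubsets-none {n} too-small)
  where
  too-small : ∀ S → S ⊆ᵇ T ∧ (∣ S ∣ ≡ᵇ suc ∣ T ∣) ≡ false
  too-small S with S ⊆ᵇ T in S⊆T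
  ... | false = refl
  ... | true  = ≡ᵇ-false⁺ ∣ S ∣ (suc ∣ T ∣) (⊆ᵇ⇒∣∣≢ S T S⊆T)
subsets-of-equal-size {suc n} (false ∷ T) =
  cong₂ _+_ (countSubsets-none {n} λ _ → refl) (subsets-of-equal-size T)

subsets-one-smaller : (T : Subset n) → countSubsets (λ S → S ⊆ᵇ T ∧ (suc ∣ S ∣ ≡ᵇ ∣ T ∣)) ≡ ∣ T ∣
subsets-one-smaller []          = refl
subsets-one-smaller (true ∷ T)  =
  trans (cong₂ _+_ (subsets-one-smaller T) (subsets-of-equal-size T)) (+-comm ∣ T ∣ 1)
subsets-one-smaller {suc n} (false ∷ T) =
  cong₂ _+_ (countSubsets-none {n} λ _ → refl) (subsets-one-smaller T)

module InducedSubgraphs {n : ℕ} (G : Graph n) where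

  open Graph G renaming (sym to adj-sym; irrefl to adj-irrefl)

  adj-symm : ∀ {i j b} → adj i j ≡ b → adj j i ≡ b
  adj-symm {i} {j} = trans (adj-sym j i)

  Stable : VertexSet n → Set
  Stable S = ∀ i j → S i ≡ true → S j ≡ true → adj i j ≡ false

  IndependentIn : VertexSet n → VertexSet n → Set
  IndependentIn X S = S ⊆ X × Stable S

  DominatesIn : VertexSet n → VertexSet n → Set
  DominatesIn X S = ∀ i → X i ≡ true → S i ≡ false → ∃ λ j → S j ≡ true × adj i j ≡ true

  MaximalIn : VertexSet n → VertexSet n → Set
  MaximalIn X S = IndependentIn X S × DominatesIn X S

  WellCoveredIn : VertexSet n → ℕ → Set
  WellCoveredIn X p = ∀ S → MaximalIn X S → count S ≡ p

  NoIsolatedIn : VertexSet n → Set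
  NoIsolatedIn X = ∀ i → X i ≡ true → ∃ λ j → X j ≡ true × adj i j ≡ true

  N : VertexSet n → VertexSet n
  N S w = some λ j → S j ∧ adj w j

  N-true⁻ : ∀ {S w} → N S w ≡ true → ∃ λ j → S j ≡ true × adj w j ≡ true
  N-true⁻ {S} Nw with some-true⁻ Nw
  ... | j , Sj∧adj = j , ∧-true⁻ (S j) Sj∧adj

  N-true⁺ : ∀ {S w} j → S j ≡ true → adj w j ≡ true → N S w ≡ true
  N-true⁺ j Sj adj-wj = some-true⁺ j (cong₂ _∧_ Sj adj-wj)

  N-false⁻ : ∀ {S w} j → N S w ≡ false → S j ≡ true → adj w j ≡ false
  N-false⁻ j N≡false Sj with some-false⁻ N≡false j
  ... | Sj∧adj rewrite Sj = Sj∧adj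

  stable-∪ : ∀ {S T} → Stable S → Stable T →
             (∀ i j → S i ≡ true → T j ≡ true → adj i j ≡ false) → Stable (S ∪ T)
  stable-∪ {S} stableS stableT noEdge i j S∪Ti S∪Tj with ∨-true⁻ (S i) S∪Ti | ∨-true⁻ (S j) S∪Tj
  ... | inj₁ Si | inj₁ Sj = stableS i j Si Sj
  ... | inj₁ Si | inj₂ Tj = noEdge i j Si Tj
  ... | inj₂ Ti | inj₁ Sj = adj-symm (noEdge j i Sj Ti)
  ... | inj₂ Ti | inj₂ Tj = stableT i j Ti Tj

  stable-⁅⁆ : ∀ w → Stable ⁅ w ⁆
  stable-⁅⁆ w i j wi wj with refl ← ⁅⁆-only w i wi | refl ← ⁅⁆-only w j wj = adj-irrefl w

  stable-⊆ : ∀ {S T} → S ⊆ T → Stable T → Stable S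
  stable-⊆ S⊆T stableT i j Si Sj = stableT i j (S⊆T i Si) (S⊆T j Sj)

  ⁅⁆-independent : ∀ {X w} → X w ≡ true → IndependentIn X ⁅ w ⁆
  ⁅⁆-independent {X} {w} Xw = ⁅w⁆⊆X , stable-⁅⁆ w
    where
    ⁅w⁆⊆X : ⁅ w ⁆ ⊆ X
    ⁅w⁆⊆X i wi with refl ← ⁅⁆-only w i wi = Xw

  stable⇒independent : ∀ {S} → Stable S → IndependentIn ⊤ᵥ S
  stable⇒independent stableS = (λ _ _ → refl) , stableS

  stable-cong : ∀ {S T} → (∀ i → S i ≡ T i) → Stable S → Stable T
  stable-cong S≗T stableS i j Ti Tj = stableS i j (trans (S≗T i) Ti) (trans (S≗T j) Tj)

  Addable : VertexSet n → VertexSet n → VertexSet n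
  Addable X S = X ─ (S ∪ N S)

  insert-independent : ∀ {X S w} → IndependentIn X S → Addable X S w ≡ true →
                       IndependentIn X (S ∪ ⁅ w ⁆)
  insert-independent {X} {S} {w} (S⊆X , stableS) addable with ∧-not-∨⁻ (X w) (S w) addable
  ... | Xw , _ , Nw = ∪⊆X , stable-∪ stableS (stable-⁅⁆ w) noEdge
    where
    ∪⊆X : S ∪ ⁅ w ⁆ ⊆ X
    ∪⊆X i S∪wi with ∨-true⁻ (S i) S∪wi
    ... | inj₁ Si = S⊆X i Si
    ... | inj₂ wi with refl ← ⁅⁆-only w i wi = Xw
    noEdge : ∀ i j → S i ≡ true → ⁅ w ⁆ j ≡ true → adj i j ≡ false
    noEdge i j Si wj with refl ← ⁅⁆-only w j wj = adj-symm (N-false⁻ i Nw Si)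

  insert-shrinks : ∀ {X S w} → Addable X S w ≡ true → count (X ─ (S ∪ ⁅ w ⁆)) < count (X ─ S)
  insert-shrinks {X} {S} {w} addable with ∧-not-∨⁻ (X w) (S w) addable
  ... | Xw , Sw , _ = count-< (─-antitone {X = X} (λ i Si → ∨-trueˡ _ Si)) w
    (trans (cong (λ b → X w ∧ not b) (∨-trueʳ (S w) (⁅⁆-self w))) (Bool.∧-zeroʳ (X w)))
    (cong₂ (λ a b → a ∧ not b) Xw Sw)

  saturated-dominates : ∀ {X S} → some (Addable X S) ≡ false → DominatesIn X S
  saturated-dominates {X} {S} saturated i Xi Si with N S i in Ni
  ... | true  = N-true⁻ Ni
  ... | false = contradiction (trans (sym (∧-not-∨⁺ Xi Si Ni)) (some-false⁻ saturated i)) λ ()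

  extend-to-maximal : ∀ {X S} → IndependentIn X S → Σ[ M ∈ VertexSet n ] MaximalIn X M × S ⊆ M
  extend-to-maximal {X} {S} = go (suc (count (X ─ S))) ≤-refl
    where
    go : ∀ m {S} → count (X ─ S) < m → IndependentIn X S → Σ[ M ∈ VertexSet n ] MaximalIn X M × S ⊆ M
    go (suc m) {S} bound indS with some (Addable X S) in saturated
    ... | false = S , (indS , saturated-dominates saturated) , λ _ Si → Si
    ... | true with some-true⁻ saturated
    ... | w , addable with go m (<-≤-trans (insert-shrinks {X} {S} {w} addable) (≤-pred bound))
                                 (insert-independent {X} {S} {w} indS addable)
    ... | M , maximalM , S∪w⊆M = M , maximalM , λ i Si → S∪w⊆M i (∨-trueˡ _ Si)

  independent-≤ : ∀ {X S p} → WellCoveredIn X p → IndependentIn X S → count S ≤ p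
  independent-≤ wellCovered indS with extend-to-maximal indS
  ... | M , maximalM , S⊆M = ≤-trans (count-mono S⊆M) (≤-reflexive (wellCovered M maximalM))

  record Reduction (X : VertexSet n) (p : ℕ) : Set where
    field
      U B              : VertexSet n
      U⊆X              : U ⊆ X
      B⊆X              : B ⊆ X
      U-B-disjoint     : Disjoint U B
      B-U-complete     : ∀ b u → B b ≡ true → U u ≡ true → adj b u ≡ true
      count-B-pos      : 1 ≤ count B
      count-B≤count-U  : count B ≤ count U
      count-B≤p        : count B ≤ p
      rest-noIsolated  : NoIsolatedIn (X ─ (U ∪ B))
      rest-wellCovered : WellCoveredIn (X ─ (U ∪ B)) (p ∸ count B)

    Rest : VertexSet n
    Rest = X ─ (U ∪ B)

    count-X : count X ≡ count Rest + (count U + count B)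
    count-X = trans (count-partition X U B U-B-disjoint)
                    (cong (count Rest +_) (cong₂ _+_ (count-∩-⊆ U⊆X) (count-∩-⊆ B⊆X)))

    count-Rest< : count Rest < count X
    count-Rest< = begin-strict
      count Rest                        <⟨ m<m+n (count Rest) (<-≤-trans count-B-pos (m≤n+m (count B) (count U))) ⟩
      count Rest + (count U + count B)  ≡⟨ sym count-X ⟩
      count X                           ∎
      where open ≤-Reasoning

  module Construction {X : VertexSet n} {p : ℕ} (wellCovered : WellCoveredIn X p)
                      (noIsolated : NoIsolatedIn X) (v₀ : Fin n) (Xv₀ : X v₀ ≡ true) where

    degree : Fin n → ℕ
    degree w = count (X ∩ adj w)

    v : Fin n
    v = proj₁ (minimiser degree X v₀ Xv₀)

    Xv : X v ≡ true
    Xv = proj₁ (proj₂ (minimiser degree X v₀ Xv₀))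

    v-minimal : ∀ w → X w ≡ true → degree v ≤ degree w
    v-minimal = proj₂ (proj₂ (minimiser degree X v₀ Xv₀))

    U B : VertexSet n
    U = X ∩ adj v
    B w = X w ∧ not (some ((X ∩ adj w) ─ U))

    B⊆X : B ⊆ X
    B⊆X i Bi = proj₁ (∧-true⁻ (X i) Bi)

    B-neighbours : ∀ {w z} → B w ≡ true → X z ≡ true → adj w z ≡ true → U z ≡ true
    B-neighbours {w} {z} Bw Xz adj-wz =
      ∧-not-false⁻ (X z ∧ adj w z) (cong₂ _∧_ Xz adj-wz)
        (some-false⁻ (not-true⁻ (proj₂ (∧-true⁻ (X w) Bw))) z)

    v∈B : B v ≡ true
    v∈B = cong₂ (λ x s → x ∧ not s) Xv (some-false⁺ λ i → Bool.∧-inverseʳ (U i))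

    U-B-disjoint : Disjoint U B
    U-B-disjoint i Ui Bi = ≡true⇒≢false (B-neighbours Bi Xv (adj-symm (proj₂ (∧-true⁻ (X i) Ui))))
                                        (trans (cong (X v ∧_) (adj-irrefl v)) (Bool.∧-zeroʳ (X v)))

    B-U-complete : ∀ b u → B b ≡ true → U u ≡ true → adj b u ≡ true
    B-U-complete b u Bb Uu = proj₂ (∧-true⁻ (X u) (U⊆N[b] u Uu))
      where
      N[b]⊆U : X ∩ adj b ⊆ U
      N[b]⊆U z Nz = B-neighbours Bb (proj₁ (∧-true⁻ (X z) Nz)) (proj₂ (∧-true⁻ (X z) Nz))
      U⊆N[b] : U ⊆ X ∩ adj b
      U⊆N[b] = count-≥⇒⊇ N[b]⊆U (v-minimal b (B⊆X b Bb))

    B-stable : Stable B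
    B-stable i j Bi Bj = ¬-not λ adj-ij → U-B-disjoint j (B-neighbours Bi (B⊆X j Bj) adj-ij) Bj

    B-independent : IndependentIn X B
    B-independent = B⊆X , B-stable

    count-B≤count-U : count B ≤ count U
    count-B≤count-U with noIsolated v Xv
    ... | u , Xu , adj-vu with extend-to-maximal (⁅⁆-independent {X} Xu)
    ... | M , maximalM@((M⊆X , stableM) , _) , ⁅u⁆⊆M = begin
      count B                      ≤⟨ +-cancelˡ-≤ (count (M ─ U)) _ _ T-bound ⟩
      count (M ∩ U)                ≤⟨ count-mono (λ i MUi → proj₂ (∧-true⁻ (M i) MUi)) ⟩
      count U                      ∎
      where
      open ≤-Reasoning
      Mu : M u ≡ true
      Mu = ⁅u⁆⊆M u (⁅⁆-self u)
      M-B-disjoint : Disjoint M B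
      M-B-disjoint i Mi Bi = ≡true⇒≢false (B-U-complete i u Bi (cong₂ _∧_ Xu adj-vu)) (stableM i u Mi Mu)
      M─U⊆M : M ─ U ⊆ M
      M─U⊆M i M─Ui = proj₁ (∧-not⁻ (M i) M─Ui)
      T-independent : IndependentIn X ((M ─ U) ∪ B)
      T-independent = T⊆X , stable-∪ (stable-⊆ M─U⊆M stableM) B-stable noEdge
        where
        T⊆X : (M ─ U) ∪ B ⊆ X
        T⊆X i Ti with ∨-true⁻ ((M ─ U) i) Ti
        ... | inj₁ M─Ui = M⊆X i (M─U⊆M i M─Ui)
        ... | inj₂ Bi   = B⊆X i Bi
        noEdge : ∀ i j → (M ─ U) i ≡ true → B j ≡ true → adj i j ≡ false
        noEdge i j M─Ui Bj = ¬-not λ adj-ij →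
          ≡true⇒≢false (B-neighbours Bj (M⊆X i (M─U⊆M i M─Ui)) (adj-symm adj-ij))
                       (proj₂ (∧-not⁻ (M i) M─Ui))
      T-bound : count (M ─ U) + count B ≤ count (M ─ U) + count (M ∩ U)
      T-bound = begin
        count (M ─ U) + count B    ≡⟨ sym (count-∪ λ i M─Ui → M-B-disjoint i (M─U⊆M i M─Ui)) ⟩
        count ((M ─ U) ∪ B)        ≤⟨ independent-≤ wellCovered T-independent ⟩
        p                          ≡⟨ sym (wellCovered M maximalM) ⟩
        count M                    ≡⟨ count-split M U ⟩
        count (M ∩ U) + count (M ─ U) ≡⟨ +-comm (count (M ∩ U)) _ ⟩
        count (M ─ U) + count (M ∩ U) ∎

    Rest : VertexSet n
    Rest = X ─ (U ∪ B)

    rest⁻ : ∀ {i} → Rest i ≡ true → X i ≡ true × U i ≡ false × B i ≡ false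
    rest⁻ {i} = ∧-not-∨⁻ (X i) (U i)

    rest-noIsolated : NoIsolatedIn Rest
    rest-noIsolated w Rest-w with rest⁻ Rest-w
    ... | Xw , Uw , Bw with some-true⁻ (∧-not-false⁻ (X w) Xw Bw)
    ... | z , outside-z with ∧-not⁻ (X z ∧ adj w z) outside-z
    ... | Xz∧adj-wz , Uz with ∧-true⁻ (X z) Xz∧adj-wz
    ... | Xz , adj-wz = z , ∧-not-∨⁺ Xz Uz Bz , adj-wz
      where
      Bz : B z ≡ false
      Bz = ¬-not λ Bz → ≡true⇒≢false (B-neighbours Bz Xw (adj-symm adj-wz)) Uw

    rest-wellCovered : WellCoveredIn Rest (p ∸ count B)
    rest-wellCovered T ((T⊆Rest , stableT) , dominatesT) = begin
      count T                         ≡⟨ sym (m+n∸n≡m (count T) (count B)) ⟩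
      count T + count B ∸ count B     ≡⟨ cong (_∸ count B) (sym (count-∪ T-B-disjoint)) ⟩
      count (T ∪ B) ∸ count B         ≡⟨ cong (_∸ count B) (wellCovered (T ∪ B) T∪B-maximal) ⟩
      p ∸ count B                     ∎
      where
      open ≡-Reasoning
      T-B-disjoint : Disjoint T B
      T-B-disjoint i Ti Bi = ≡true⇒≢false Bi (proj₂ (proj₂ (rest⁻ (T⊆Rest i Ti))))
      T∪B⊆X : T ∪ B ⊆ X
      T∪B⊆X i T∪Bi with ∨-true⁻ (T i) T∪Bi
      ... | inj₁ Ti = proj₁ (rest⁻ (T⊆Rest i Ti))
      ... | inj₂ Bi = B⊆X i Bi
      noEdge : ∀ i j → T i ≡ true → B j ≡ true → adj i j ≡ false
      noEdge i j Ti Bj with rest⁻ (T⊆Rest i Ti)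
      ... | Xi , Ui , _ = ¬-not λ adj-ij → ≡true⇒≢false (B-neighbours Bj Xi (adj-symm adj-ij)) Ui
      T∪B-dominates : DominatesIn X (T ∪ B)
      T∪B-dominates i Xi T∪Bi
        with Bool.∨-conicalˡ (T i) (B i) T∪Bi | Bool.∨-conicalʳ (T i) (B i) T∪Bi | U i in Ui
      ... | _  | _  | true = v , ∨-trueʳ (T v) v∈B , adj-symm (proj₂ (∧-true⁻ (X i) Ui))
      ... | Ti | Bi | false with dominatesT i (∧-not-∨⁺ Xi Ui Bi) Ti
      ... | j , Tj , adj-ij = j , ∨-trueˡ (B j) Tj , adj-ij
      T∪B-maximal : MaximalIn X (T ∪ B)
      T∪B-maximal = (T∪B⊆X , stable-∪ stableT B-stable noEdge) , T∪B-dominates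

    U⊆X : U ⊆ X
    U⊆X i Ui = proj₁ (∧-true⁻ (X i) Ui)

  reduce : ∀ {X p} → WellCoveredIn X p → NoIsolatedIn X → ∀ v₀ → X v₀ ≡ true → Reduction X p
  reduce wellCovered noIsolated v₀ Xv₀ = record
    { U                = U
    ; B                = B
    ; U⊆X              = U⊆X
    ; B⊆X              = B⊆X
    ; U-B-disjoint     = U-B-disjoint
    ; B-U-complete     = B-U-complete
    ; count-B-pos      = count-pos v v∈B
    ; count-B≤count-U  = count-B≤count-U
    ; count-B≤p        = independent-≤ wellCovered B-independent
    ; rest-noIsolated  = rest-noIsolated
    ; rest-wellCovered = rest-wellCovered
    }
    where open Construction wellCovered noIsolated v₀ Xv₀

  empty-wellCovered : ∀ {X p} → (∀ i → X i ≡ false) → WellCoveredIn X p → p ≡ 0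
  empty-wellCovered {X} X≡∅ wellCovered =
    trans (sym (wellCovered (λ _ → false) (((λ _ ()) , (λ _ _ ())) , dominates)))
          (count-empty {n} {λ _ → false} λ _ → refl)
    where
    dominates : DominatesIn X (λ _ → false)
    dominates i Xi _ = contradiction Xi (λ Xi → ≡true⇒≢false Xi (X≡∅ i))

  twice-≤-count : ∀ {X p} → WellCoveredIn X p → NoIsolatedIn X → 2 * p ≤ count X
  twice-≤-count {X} = go (suc (count X)) ≤-refl
    where
    go : ∀ m {X p} → count X < m → WellCoveredIn X p → NoIsolatedIn X → 2 * p ≤ count X
    go (suc m) {X} {p} bound wellCovered noIsolated with some X in nonempty
    ... | false rewrite empty-wellCovered (some-false⁻ nonempty) wellCovered = z≤n
    ... | true with some-true⁻ nonempty
    ... | v₀ , Xv₀ = begin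
      2 * p                              ≡⟨ cong (2 *_) (sym (m∸n+n≡m count-B≤p)) ⟩
      2 * (q + b)                        ≡⟨ *-distribˡ-+ 2 q b ⟩
      2 * q + 2 * b                      ≤⟨ +-mono-≤ ih (≤-reflexive (cong (b +_) (+-identityʳ b))) ⟩
      count Rest + (b + b)               ≤⟨ +-monoʳ-≤ (count Rest) (+-monoˡ-≤ b count-B≤count-U) ⟩
      count Rest + (count U + b)         ≡⟨ sym count-X ⟩
      count X                            ∎
      where
      open ≤-Reasoning
      open Reduction (reduce wellCovered noIsolated v₀ Xv₀)
      b = count B
      q = p ∸ b
      ih : 2 * q ≤ count Rest
      ih = go m (<-≤-trans count-Rest< (≤-pred bound)) rest-wellCovered rest-noIsolated

  module _ {X p} (r : Reduction X p) where

    open Reduction r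

    tight-reduction : count X ≡ 2 * p → count Rest ≡ 2 * (p ∸ count B) × count U ≡ count B
    tight-reduction count-X≡2p =
      proj₁ squeezed , +-cancelʳ-≡ (count B) (count U) (count B) (proj₂ squeezed)
      where
      q = p ∸ count B
      squeezed : count Rest ≡ 2 * q × count U + count B ≡ count B + count B
      squeezed = +-squeeze (twice-≤-count rest-wellCovered rest-noIsolated)
                           (+-monoˡ-≤ (count B) count-B≤count-U) $ begin
        count Rest + (count U + count B)  ≡⟨ sym count-X ⟩
        count X                           ≡⟨ count-X≡2p ⟩
        2 * p                             ≡⟨ cong (2 *_) (sym (m∸n+n≡m count-B≤p)) ⟩
        2 * (q + count B)                 ≡⟨ *-distribˡ-+ 2 q (count B) ⟩
        2 * q + 2 * count B               ≡⟨ cong (λ b → 2 * q + (count B + b)) (+-identityʳ (count B)) ⟩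
        2 * q + (count B + count B)       ∎
        where open ≡-Reasoning

    rest-independent : ∀ {A} → IndependentIn X A → IndependentIn Rest (A ─ (U ∪ B))
    rest-independent {A} (A⊆X , stableA) = A'⊆Rest , stable-⊆ (λ i A'i → proj₁ (∧-not⁻ (A i) A'i)) stableA
      where
      A'⊆Rest : A ─ (U ∪ B) ⊆ Rest
      A'⊆Rest i A'i with ∧-not-∨⁻ (A i) (U i) A'i
      ... | Ai , Ui , Bi = ∧-not-∨⁺ (A⊆X i Ai) Ui Bi

    rest-neighbours : ∀ {A} → Rest ∩ N (A ─ (U ∪ B)) ⊆ (X ∩ N A) ─ (U ∪ B)
    rest-neighbours {A} i Rest∩N[A']i with ∧-true⁻ (Rest i) Rest∩N[A']i
    ... | Rest-i , N[A']i with ∧-not-∨⁻ (X i) (U i) Rest-i | N-true⁻ {A ─ (U ∪ B)} N[A']i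
    ... | Xi , Ui , Bi | j , A'j , adj-ij =
      ∧-not-∨⁺ (cong₂ _∧_ Xi (N-true⁺ j (proj₁ (∧-not⁻ (A j) A'j)) adj-ij)) Ui Bi

    -- A cannot meet both U and B, and whichever of the two it meets, the other lies in N(A).
    boundary-≤-neighbours : count U ≡ count B → ∀ {A} → Stable A →
                            count (A ∩ U) + count (A ∩ B) ≤ count ((X ∩ N A) ∩ U) + count ((X ∩ N A) ∩ B)
    boundary-≤-neighbours tight {A} stableA with some (A ∩ B) in meetsB
    ... | true with some-true⁻ meetsB
    ... | b₀ , A∩Bb₀ with ∧-true⁻ (A b₀) A∩Bb₀
    ... | Ab₀ , Bb₀ = begin
      count (A ∩ U) + count (A ∩ B)   ≡⟨ cong (_+ count (A ∩ B)) (count-empty {n} A∩U≡∅) ⟩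
      count (A ∩ B)                   ≤⟨ count-mono (λ i A∩Bi → proj₂ (∧-true⁻ (A i) A∩Bi)) ⟩
      count B                         ≤⟨ count-B≤count-U ⟩
      count U                         ≤⟨ count-mono U⊆N[A] ⟩
      count ((X ∩ N A) ∩ U)           ≤⟨ m≤m+n _ _ ⟩
      count ((X ∩ N A) ∩ U) + count ((X ∩ N A) ∩ B) ∎
      where
      open ≤-Reasoning
      A∩U≡∅ : ∀ i → (A ∩ U) i ≡ false
      A∩U≡∅ i = ¬-not λ A∩Ui → ≡true⇒≢false (B-U-complete b₀ i Bb₀ (proj₂ (∧-true⁻ (A i) A∩Ui)))
                                           (stableA b₀ i Ab₀ (proj₁ (∧-true⁻ (A i) A∩Ui)))
      U⊆N[A] : U ⊆ (X ∩ N A) ∩ U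
      U⊆N[A] i Ui = cong₂ _∧_ (cong₂ _∧_ (U⊆X i Ui) (N-true⁺ b₀ Ab₀ (adj-symm (B-U-complete b₀ i Bb₀ Ui)))) Ui
    boundary-≤-neighbours tight {A} stableA | false with some (A ∩ U) in meetsU
    ... | true with some-true⁻ meetsU
    ... | u₀ , A∩Uu₀ with ∧-true⁻ (A u₀) A∩Uu₀
    ... | Au₀ , Uu₀ = begin
      count (A ∩ U) + count (A ∩ B)   ≡⟨ cong (count (A ∩ U) +_) (count-empty {n} (some-false⁻ {n} meetsB)) ⟩
      count (A ∩ U) + 0               ≡⟨ +-identityʳ _ ⟩
      count (A ∩ U)                   ≤⟨ count-mono (λ i A∩Ui → proj₂ (∧-true⁻ (A i) A∩Ui)) ⟩
      count U                         ≡⟨ tight ⟩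
      count B                         ≤⟨ count-mono B⊆N[A] ⟩
      count ((X ∩ N A) ∩ B)           ≤⟨ m≤n+m _ _ ⟩
      count ((X ∩ N A) ∩ U) + count ((X ∩ N A) ∩ B) ∎
      where
      open ≤-Reasoning
      B⊆N[A] : B ⊆ (X ∩ N A) ∩ B
      B⊆N[A] i Bi = cong₂ _∧_ (cong₂ _∧_ (B⊆X i Bi) (N-true⁺ u₀ Au₀ (B-U-complete i u₀ Bi Uu₀))) Bi
    boundary-≤-neighbours tight {A} stableA | false | false =
      ≤-trans (≤-reflexive (cong₂ _+_ (count-empty {n} (some-false⁻ {n} meetsU))
                                      (count-empty {n} (some-false⁻ {n} meetsB))))
              z≤n

  independent-≤-neighbours : ∀ {X p} → WellCoveredIn X p → NoIsolatedIn X → count X ≡ 2 * p →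
                             ∀ {A} → IndependentIn X A → count A ≤ count (X ∩ N A)
  independent-≤-neighbours {X} = go (suc (count X)) ≤-refl
    where
    go : ∀ m {X p} → count X < m → WellCoveredIn X p → NoIsolatedIn X → count X ≡ 2 * p →
         ∀ {A} → IndependentIn X A → count A ≤ count (X ∩ N A)
    go (suc m) {X} {p} bound wellCovered noIsolated count-X≡2p {A} indA@(A⊆X , stableA) with some X in nonempty
    ... | false = ≤-trans (≤-reflexive (count-empty {n} A≡∅)) z≤n
      where
      A≡∅ : ∀ i → A i ≡ false
      A≡∅ i = ¬-not λ Ai → ≡true⇒≢false (A⊆X i Ai) (some-false⁻ {n} nonempty i)
    ... | true with some-true⁻ nonempty
    ... | v₀ , Xv₀ = begin
      count A                                                          ≡⟨ count-partition A U B U-B-disjoint ⟩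
      count (A ─ (U ∪ B)) + (count (A ∩ U) + count (A ∩ B))            ≤⟨ +-mono-≤ inside boundary ⟩
      count (N[A] ─ (U ∪ B)) + (count (N[A] ∩ U) + count (N[A] ∩ B))  ≡⟨ sym (count-partition N[A] U B U-B-disjoint) ⟩
      count N[A]                                                       ∎
      where
      open ≤-Reasoning
      r = reduce wellCovered noIsolated v₀ Xv₀
      open Reduction r
      N[A] = X ∩ N A
      tight = tight-reduction r count-X≡2p
      inside : count (A ─ (U ∪ B)) ≤ count (N[A] ─ (U ∪ B))
      inside = ≤-trans (go m (<-≤-trans count-Rest< (≤-pred bound)) rest-wellCovered rest-noIsolated
                           (proj₁ tight) (rest-independent r indA))
                       (count-mono (rest-neighbours r))
      boundary : count (A ∩ U) + count (A ∩ B) ≤ count (N[A] ∩ U) + count (N[A] ∩ B)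
      boundary = boundary-≤-neighbours r (proj₂ tight) stableA

  isIndep⁻ : ∀ S → isIndep G S ≡ true → Stable (lookup S)
  isIndep⁻ S indS i j Si Sj =
    trans (cong₂ (λ a b → a ∧ (b ∧ adj i j)) (sym Si) (sym Sj))
          (not-true⁻ (all-allFin⁻ _ (all-allFin⁻ _ indS i) j))

  isIndep⁺ : ∀ S → Stable (lookup S) → isIndep G S ≡ true
  isIndep⁺ S stableS = all-allFin⁺ _ λ i → all-allFin⁺ _ λ j → pair i j
    where
    pair : ∀ i j → not (lookup S i ∧ lookup S j ∧ adj i j) ≡ true
    pair i j with lookup S i in Si | lookup S j in Sj
    ... | false | _     = refl
    ... | true  | false = refl
    ... | true  | true  = cong not (stableS i j Si Sj)

module VeryWellCoveredGraph {n : ℕ} (G : Graph n) (veryWellCovered : VeryWellCovered G) where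

  open InducedSubgraphs G
  open Graph G using (adj)

  private
    wellCovered = proj₁ veryWellCovered
    noIsolated  = proj₁ (proj₂ veryWellCovered)
    n≡2α        = proj₂ (proj₂ veryWellCovered)

  maximal⇒MaximalIndependent : ∀ {M} → MaximalIn ⊤ᵥ M → MaximalIndependent G (tabulate M)
  maximal⇒MaximalIndependent {M} ((_ , stableM) , dominatesM) = independent , maximal
    where
    M-member : ∀ {x} → M x ≡ true → x ∈ₛ tabulate M
    M-member {x} Mx = lookup⇒[]= x (tabulate M) (trans (lookup∘tabulate M x) Mx)
    independent : Independent G (tabulate M)
    independent = isIndep⁺ (tabulate M) (stable-cong (sym ∘ lookup∘tabulate M) stableM)
    maximal : ∀ T → Independent G T → tabulate M ⊆ₛ T → T ⊆ₛ tabulate M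
    maximal T indT M⊆T {x} x∈T with M x in Mx
    ... | true  = M-member Mx
    ... | false with dominatesM x refl Mx
    ... | j , Mj , adj-xj = ⊥-elim (≡true⇒≢false adj-xj
            (isIndep⁻ T indT x j ([]=⇒lookup x∈T) ([]=⇒lookup (M⊆T (M-member Mj)))))

  wellCovered-⊤ : WellCoveredIn ⊤ᵥ (α G)
  wellCovered-⊤ S maximalS = ≤-antisym (subst (_≤ α G) (∣tabulate∣≡count S) α-upper) α-lower
    where
    α-upper : ∣ tabulate S ∣ ≤ α G
    α-upper = foldr-⊔-upper ∣_∣ (indepSets G)
      (∈-bfilter⁺ (isIndep G) (allSubsets n) (∈-allSubsets (tabulate S)) (proj₁ (maximal⇒MaximalIndependent maximalS)))
    bounded : ∀ T → T ∈ indepSets G → ∣ T ∣ ≤ count S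
    bounded T T∈ with extend-to-maximal {⊤ᵥ}
                        (stable⇒independent (isIndep⁻ T (proj₂ (∈-bfilter⁻ (isIndep G) (allSubsets n) T∈))))
    ... | M , maximalM , T⊆M = begin
      ∣ T ∣                 ≡⟨ ∣∣≡count T ⟩
      count (lookup T)      ≤⟨ count-mono T⊆M ⟩
      count M               ≡⟨ sym (∣tabulate∣≡count M) ⟩
      ∣ tabulate M ∣        ≡⟨ wellCovered _ _ (maximal⇒MaximalIndependent maximalM) (maximal⇒MaximalIndependent maximalS) ⟩
      ∣ tabulate S ∣        ≡⟨ ∣tabulate∣≡count S ⟩
      count S               ∎
      where open ≤-Reasoning
    α-lower : α G ≤ count S
    α-lower = foldr-⊔-least ∣_∣ (indepSets G) bounded

  noIsolated-⊤ : NoIsolatedIn ⊤ᵥ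
  noIsolated-⊤ v _ with some (adj v) in adjacent
  ... | true  = let u , adj-vu = some-true⁻ adjacent in u , refl , adj-vu
  ... | false = ⊥-elim (noIsolated v (some-false⁻ adjacent))

  count-⊤≡2α : count (⊤ᵥ {n}) ≡ 2 * α G
  count-⊤≡2α = trans (count-⊤ {n}) n≡2α

  module _ {A : VertexSet n} (stableA : Stable A) {k r : ℕ} (count-A : count A ≡ k)
           (α≡k+r : α G ≡ k + r) where

    addable-lower : r ≤ count (Addable ⊤ᵥ A)
    addable-lower with extend-to-maximal {⊤ᵥ} {A} (stable⇒independent stableA)
    ... | M , maximalM@((_ , stableM) , _) , A⊆M = +-cancelˡ-≤ k r _ $ begin
      k + r                               ≡⟨ sym α≡k+r ⟩
      α G                                 ≡⟨ sym (wellCovered-⊤ M maximalM) ⟩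
      count M                             ≡⟨ count-split M A ⟩
      count (M ∩ A) + count (M ─ A)       ≤⟨ +-mono-≤ (count-mono (λ i M∩Ai → proj₂ (∧-true⁻ (M i) M∩Ai))) (count-mono M─A⊆W) ⟩
      count A + count (Addable ⊤ᵥ A)      ≡⟨ cong (_+ _) count-A ⟩
      k + count (Addable ⊤ᵥ A)            ∎
      where
      open ≤-Reasoning
      M─A⊆W : M ─ A ⊆ Addable ⊤ᵥ A
      M─A⊆W i M─Ai with ∧-not⁻ (M i) M─Ai
      ... | Mi , Ai = ∧-not-∨⁺ refl Ai (¬-not λ NAi →
        let j , Aj , adj-ij = N-true⁻ {A} NAi in ≡true⇒≢false adj-ij (stableM i j Mi (A⊆M j Aj)))

    addable-upper : count (Addable ⊤ᵥ A) ≤ 2 * r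
    addable-upper = +-cancelʳ-≤ (k + k) _ _ $ begin
      count (Addable ⊤ᵥ A) + (k + k)                        ≡⟨ cong (λ a → count (Addable ⊤ᵥ A) + (a + k)) (sym count-A) ⟩
      count (Addable ⊤ᵥ A) + (count A + k)                  ≤⟨ +-monoʳ-≤ (count (Addable ⊤ᵥ A)) (+-monoʳ-≤ (count A) k≤N[A]) ⟩
      count (Addable ⊤ᵥ A) + (count A + count (⊤ᵥ ∩ N A))   ≡⟨ sym (count-partition ⊤ᵥ A (N A) A-N[A]-disjoint) ⟩
      count (⊤ᵥ {n})                                        ≡⟨ count-⊤≡2α ⟩
      2 * α G                                               ≡⟨ cong (2 *_) α≡k+r ⟩
      2 * (k + r)                                           ≡⟨ twice-+ k r ⟩
      2 * r + (k + k)                                       ∎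
      where
      open ≤-Reasoning
      A-N[A]-disjoint : Disjoint A (N A)
      A-N[A]-disjoint i Ai NAi = let j , Aj , adj-ij = N-true⁻ {A} NAi in ≡true⇒≢false adj-ij (stableA i j Ai Aj)
      k≤N[A] : k ≤ count (⊤ᵥ ∩ N A)
      k≤N[A] = subst (_≤ _) count-A
                 (independent-≤-neighbours wellCovered-⊤ noIsolated-⊤ count-⊤≡2α (stable⇒independent stableA))

  independentOfSize : ℕ → List (Subset n)
  independentOfSize k = bfilter (λ S → ∣ S ∣ ≡ᵇ k) (indepSets G)

  ∈-independentOfSize⁻ : ∀ {k S} → S ∈ independentOfSize k → isIndep G S ≡ true × ∣ S ∣ ≡ k
  ∈-independentOfSize⁻ {k} {S} S∈ with ∈-bfilter⁻ (λ S → ∣ S ∣ ≡ᵇ k) (indepSets G) S∈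
  ... | S∈indep , size = proj₂ (∈-bfilter⁻ (isIndep G) (allSubsets n) S∈indep) , ≡ᵇ-true⁻ ∣ S ∣ k size

  insertable : ∀ A → isIndep G A ≡ true → ∀ w →
               not (lookup A w) ∧ isIndep G (insert A w) ≡ Addable ⊤ᵥ (lookup A) w
  insertable A indA w with lookup A w in Aw
  ... | true  = refl
  ... | false with N (lookup A) w in Nw
  ...   | false = isIndep⁺ (insert A w) (stable-cong (sym ∘ lookup-insert A w)
                    (proj₂ (insert-independent {⊤ᵥ} {lookup A} {w} (stable⇒independent (isIndep⁻ A indA))
                                               (∧-not-∨⁺ refl Aw Nw))))
  ...   | true  = ¬-not λ indA+w →
    let j , Aj , adj-wj = N-true⁻ {lookup A} Nw in
    ≡true⇒≢false adj-wj (isIndep⁻ (insert A w) indA+w w j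
      (trans (lookup-insert A w w) (∨-trueʳ (lookup A w) (⁅⁆-self w)))
      (trans (lookup-insert A w j) (∨-trueˡ _ Aj)))

  extensionCount : ℕ → Subset n → ℕ
  extensionCount k A = length (bfilter (A ⊆ᵇ_) (independentOfSize (suc k)))

  length-extensions : ∀ {k A} → A ∈ independentOfSize k → extensionCount k A ≡ count (Addable ⊤ᵥ (lookup A))
  length-extensions {k} {A} A∈ with ∈-independentOfSize⁻ A∈
  ... | indA , refl = begin
    length (bfilter (A ⊆ᵇ_) (independentOfSize (suc k)))
      ≡⟨ cong length (trans (bfilter-bfilter _ _ (indepSets G)) (bfilter-bfilter _ _ (allSubsets n))) ⟩
    length (bfilter (λ T → isIndep G T ∧ ((∣ T ∣ ≡ᵇ suc k) ∧ A ⊆ᵇ T)) (allSubsets n))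
      ≡⟨ cong length (bfilter-cong (λ T → ∧-rotate (isIndep G T) (∣ T ∣ ≡ᵇ suc k) (A ⊆ᵇ T)) (allSubsets n)) ⟩
    length (bfilter (λ T → A ⊆ᵇ T ∧ ((∣ T ∣ ≡ᵇ suc k) ∧ isIndep G T)) (allSubsets n))
      ≡⟨ length-bfilter-allSubsets {n} _ ⟩
    countSubsets (λ T → A ⊆ᵇ T ∧ ((∣ T ∣ ≡ᵇ suc k) ∧ isIndep G T))
      ≡⟨ one-point-extensions A (isIndep G) ⟩
    count (λ w → not (lookup A w) ∧ isIndep G (insert A w))
      ≡⟨ count-cong (insertable A indA) ⟩
    count (Addable ⊤ᵥ (lookup A)) ∎
    where open ≡-Reasoning

  length-restrictions : ∀ {k B} → B ∈ independentOfSize (suc k) →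
                        length (bfilter (_⊆ᵇ B) (independentOfSize k)) ≡ suc k
  length-restrictions {k} {B} B∈ with ∈-independentOfSize⁻ B∈
  ... | indB , ∣B∣≡1+k = begin
    length (bfilter (_⊆ᵇ B) (independentOfSize k))
      ≡⟨ cong length (trans (bfilter-bfilter _ _ (indepSets G)) (bfilter-bfilter _ _ (allSubsets n))) ⟩
    length (bfilter (λ S → isIndep G S ∧ ((∣ S ∣ ≡ᵇ k) ∧ S ⊆ᵇ B)) (allSubsets n))
      ≡⟨ cong length (bfilter-cong subsets-independent (allSubsets n)) ⟩
    length (bfilter (λ S → S ⊆ᵇ B ∧ (suc ∣ S ∣ ≡ᵇ suc k)) (allSubsets n))
      ≡⟨ length-bfilter-allSubsets {n} _ ⟩
    countSubsets (λ S → S ⊆ᵇ B ∧ (suc ∣ S ∣ ≡ᵇ suc k))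
      ≡⟨ subst (λ m → countSubsets (λ S → S ⊆ᵇ B ∧ (suc ∣ S ∣ ≡ᵇ m)) ≡ m) ∣B∣≡1+k (subsets-one-smaller B) ⟩
    suc k ∎
    where
    open ≡-Reasoning
    subsets-independent : ∀ S → isIndep G S ∧ ((∣ S ∣ ≡ᵇ k) ∧ S ⊆ᵇ B) ≡ S ⊆ᵇ B ∧ (∣ S ∣ ≡ᵇ k)
    subsets-independent S with S ⊆ᵇ B in S⊆B
    ... | false = trans (cong (isIndep G S ∧_) (Bool.∧-zeroʳ _)) (Bool.∧-zeroʳ _)
    ... | true rewrite isIndep⁺ S (stable-⊆ (⊆ᵇ-lookup S B S⊆B) (isIndep⁻ B indB)) = Bool.∧-identityʳ _

  sum-extensions : ∀ k → sum (map (extensionCount k) (independentOfSize k)) ≡ suc k * s G (suc k)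
  sum-extensions k = begin
    sum (map (extensionCount k) (independentOfSize k))
      ≡⟨ double-counting _⊆ᵇ_ (independentOfSize k) (independentOfSize (suc k)) ⟩
    sum (map (λ B → length (bfilter (_⊆ᵇ B) (independentOfSize k))) (independentOfSize (suc k)))
      ≡⟨ sum-map-cong (independentOfSize (suc k)) (λ _ → length-restrictions) ⟩
    sum (map (λ _ → suc k) (independentOfSize (suc k)))
      ≡⟨ sum-map-const (suc k) (independentOfSize (suc k)) ⟩
    suc k * s G (suc k) ∎
    where open ≡-Reasoning

  module _ {k r : ℕ} (α≡k+r : α G ≡ k + r) where

    extension-bounds : ∀ {A} → A ∈ independentOfSize k → r ≤ extensionCount k A × extensionCount k A ≤ 2 * r
    extension-bounds {A} A∈ with ∈-independentOfSize⁻ A∈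
    ... | indA , ∣A∣≡k rewrite length-extensions A∈ =
      addable-lower stable count-A α≡k+r , addable-upper stable count-A α≡k+r
      where
      stable = isIndep⁻ A indA
      count-A = trans (sym (∣∣≡count A)) ∣A∣≡k

    s-lower : r * s G k ≤ suc k * s G (suc k)
    s-lower = begin
      r * s G k                                          ≡⟨ sym (sum-map-const r (independentOfSize k)) ⟩
      sum (map (λ _ → r) (independentOfSize k))          ≤⟨ sum-map-mono (independentOfSize k) (λ _ → proj₁ ∘ extension-bounds) ⟩
      sum (map (extensionCount k) (independentOfSize k)) ≡⟨ sum-extensions k ⟩
      suc k * s G (suc k)                                ∎
      where open ≤-Reasoning

    s-upper : suc k * s G (suc k) ≤ 2 * r * s G k
    s-upper = begin
      suc k * s G (suc k)                                ≡⟨ sym (sum-extensions k) ⟩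
      sum (map (extensionCount k) (independentOfSize k)) ≤⟨ sum-map-mono (independentOfSize k) (λ _ → proj₂ ∘ extension-bounds) ⟩
      sum (map (λ _ → 2 * r) (independentOfSize k))      ≡⟨ sum-map-const (2 * r) (independentOfSize k) ⟩
      2 * r * s G k                                      ∎
      where open ≤-Reasoning

corollary3p8 : ∀ {n} (G : Graph n) → VeryWellCovered G → α G ≤ 5 → LogConcave G
corollary3p8 G veryWellCovered α≤5 (suc j) _ 1+j≤α-1 with ≤∸1⇒≡+2+ 1+j≤α-1
... | d , α≡j+2+d =
  log-concavity-step j d (s G j) (s G (suc j)) (s G (suc (suc j))) (small-product j d j+d≤3)
    (s-lower {j} α≡j+2+d) (s-upper {suc j} (trans α≡j+2+d (+-suc j (suc d))))
  where
  open VeryWellCoveredGraph G veryWellCovered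
  j+d≤3 : j + d ≤ 3
  j+d≤3 = +-cancelˡ-≤ 2 _ _ (≤-trans (≤-reflexive (sym (+-suc-suc j d))) (subst (_≤ 5) α≡j+2+d α≤5))
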